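{- For each edit type $\mathrm{edit} \in \{\mathrm{sub}, \mathrm{ins}, \mathrm{del}\}$, $\mathrm{AS}_{\mathrm{edit}}(z_{78}, n) = \Omega(n)$.
   Context: Strings are over an alphabet $\Sigma$ that is not of bounded size (strings may use arbitrarily many distinct characters). The LZ78 factorization of a string $T$ is $T = f_1\cdots f_z$ where each phrase $f_k$ is the shortest prefix of the remaining suffix $T[|f_1\cdots f_{k-1}|+1..n]$ that differs from all previous phrases $f_1,\dots,f_{k-1}$ (so $f_k$ with its last character removed is empty or equals some earlier phrase); the last phrase may equal an earlier phrase if the string ends. $z_{78}(T)$ denotes the number of phrases. For a measure $c$, $\mathrm{AS}_{\mathrm{edit}}(c,n) = \max\{c(T')-c(T)\}$ over all strings $T$ of length $n$ and all $T'$ obtained from $T$ by a single edit of the given type (substitution, insertion or deletion of one character). $\Omega(n)$ means there is a constant $C>0$ with $\mathrm{AS}_{\mathrm{edit}}(z_{78},n) \ge C n$ for infinitely many $n$. -}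

module Defs where

open import Data.Nat using (ℕ; zero; suc; _+_; _*_; _≤_; _<_; _≥_)
open import Data.Nat.Properties using () renaming (_≟_ to _≟ℕ_)
open import Data.List using (List; []; _∷_; _++_; [_]; length; take; drop)
open import Data.List.Properties using (≡-dec)
open import Data.List.Membership.DecPropositional (≡-dec _≟ℕ_) using (_∈?_)
open import Data.Product using (_×_; _,_; ∃-syntax)
open import Relation.Nullary using (yes; no)
open import Relation.Binary.PropositionalEquality using (_≡_)

-- Alphabet: ℕ (unbounded; strings may use arbitrarily many characters).
Str : Set
Str = List ℕ

-- Extract one LZ78 phrase: given the dictionary D of previous phrases, the
-- prefix p read so far (p is empty or a previous phrase) and the remaining
-- text, extend p one character at a time until it differs from all previous
-- phrases.  If the text ends first, the last phrase is p (may equal an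
-- earlier phrase).
lzStep : List Str → Str → Str → Str × Str
lzStep D p [] = p , []
lzStep D p (c ∷ r) with (p ++ [ c ]) ∈? D
... | yes _ = lzStep D (p ++ [ c ]) r
... | no  _ = p ++ [ c ] , r

-- LZ78 factorization, with fuel (each phrase consumes ≥ 1 character,
-- so fuel = length T suffices).
lzFact : ℕ → List Str → Str → List Str
lzFact zero    D _       = []
lzFact (suc k) D []      = []
lzFact (suc k) D (c ∷ r) with lzStep D [] (c ∷ r)
... | f , r' = f ∷ lzFact k (D ++ [ f ]) r'

lz78 : Str → List Str
lz78 T = lzFact (length T) [] T

z78 : Str → ℕ
z78 T = length (lz78 T)

data EditType : Set where
  sub ins del : EditType

-- Edit e T T' : T' is obtained from T by a single edit of type e
-- (positions are 0-based).
Edit : EditType → Str → Str → Set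
Edit sub T T' = ∃[ i ] ∃[ c ] (i < length T × T' ≡ take i T ++ c ∷ drop (suc i) T)
Edit ins T T' = ∃[ i ] ∃[ c ] (i ≤ length T × T' ≡ take i T ++ c ∷ drop i T)
Edit del T T' = ∃[ i ] (i < length T × T' ≡ take i T ++ drop (suc i) T)

-- If every phrase of a list P of strings has all its proper prefixes earlier in P,
-- and some rank of the phrases increases strictly along P (so they are pairwise
-- distinct), then P is the LZ78 factorization of its concatenation.
--
-- With letters y < v₀ < … < vₘ, a fresh letter u and s, w₀, …, wₘ above
-- everything, the text
--   T = (y) (v₀) … (vₘ) (u) (u v₀) … (u vₘ) (u s) (u v₀ w₀) … (u vₘ wₘ)
-- has 6m + 10 letters and 3m + 6 phrases.  Deleting the lone u shifts the phase:
--   (y) (v₀) … (vₘ) (u) (v₀ u) … (vₘ u) (s) (u v₀) (w₀) … (u vₘ) (wₘ)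
-- so the pairs u vⱼ are no longer known and every triple splits in two, giving
-- 4m + 7 phrases.  Substituting a fresh letter x for that u, or inserting y after
-- it, has the same effect.  Read as base-u numerals the phrases increase in each
-- of these factorizations, so z₇₈ grows by at least m + 1 while |T| = 6m + 10.

module Submission where

open import Defs
open import Data.Nat using (ℕ; zero; suc; _+_; _*_; _≤_; _<_; _≥_; s≤s; z<s)
open import Data.Nat.Properties
open import Data.Nat.Tactic.RingSolver using (solve-∀)
open import Data.List using (List; []; _∷_; _++_; [_]; length; take; drop; concat; applyUpTo; foldl)
open import Data.List.Properties
  using (≡-dec; ++-assoc; ++-identityʳ; length-++; length-++-≤ˡ; length-++-≤ʳ; length-applyUpTo; concat-++)
open import Data.List.Membership.Propositional using (_∈_; _∉_)
open import Data.List.Membership.DecPropositional (≡-dec _≟_) using (_∈?_)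
open import Data.List.Membership.Propositional.Properties using (∈-++⁺ˡ; ∈-++⁺ʳ; ∈-applyUpTo⁺)
open import Data.List.Relation.Binary.Subset.Propositional using (_⊆_)
open import Data.List.Relation.Binary.Subset.Propositional.Properties using (xs⊆xs++ys; ⊆-trans)
open import Data.List.Relation.Unary.All as All using (All; []; _∷_)
open import Data.List.Relation.Unary.All.Properties using (++⁺; concat⁺; applyUpTo⁺₁; applyUpTo⁺₂)
open import Data.List.Relation.Unary.Any using (here; there)
open import Data.Product using (_×_; _,_; ∃-syntax)
open import Data.Empty using (⊥; ⊥-elim)
open import Function using (_∘_)
open import Relation.Nullary using (yes; no)
open import Relation.Binary.PropositionalEquality
  using (_≡_; refl; sym; trans; cong; cong₂; subst; subst₂; module ≡-Reasoning)

-- KnownPrefixes D p c q: every proper prefix of p ++ c ∷ q that strictly extends p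
-- is in D, so that lzStep started from p reads exactly p ++ c ∷ q if that is new.
data KnownPrefixes (D : List Str) (p : Str) : ℕ → Str → Set where
  last : ∀ {c} → KnownPrefixes D p c []
  _∷_  : ∀ {c c′ q} → p ++ [ c ] ∈ D → KnownPrefixes D (p ++ [ c ]) c′ q →
         KnownPrefixes D p c (c′ ∷ q)

lzStep-newPhrase : ∀ {D p c q} r → KnownPrefixes D p c q → p ++ c ∷ q ∉ D →
                   lzStep D p (c ∷ q ++ r) ≡ (p ++ c ∷ q , r)
lzStep-newPhrase {D} {p} {c} r last new with (p ++ [ c ]) ∈? D
... | yes old = ⊥-elim (new old)
... | no _    = refl
lzStep-newPhrase {D} {p} {c} {c′ ∷ q} r (pc∈D ∷ known) new with (p ++ [ c ]) ∈? D
... | no pc∉D = ⊥-elim (pc∉D pc∈D)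
... | yes _   = trans (lzStep-newPhrase r known (new ∘ subst (_∈ D) assoc)) (cong (_, r) assoc)
  where assoc = ++-assoc p [ c ] (c′ ∷ q)

lzFact-newPhrase : ∀ {f D c q} r → KnownPrefixes D [] c q → c ∷ q ∉ D →
                   lzFact (suc f) D (c ∷ q ++ r) ≡ (c ∷ q) ∷ lzFact f (D ++ [ c ∷ q ]) r
lzFact-newPhrase r known new rewrite lzStep-newPhrase r known new = refl

KnownPrefixes-⊆ : ∀ {D E p c q} → D ⊆ E → KnownPrefixes D p c q → KnownPrefixes E p c q
KnownPrefixes-⊆ D⊆E last           = last
KnownPrefixes-⊆ D⊆E (pc∈D ∷ known) = D⊆E pc∈D ∷ KnownPrefixes-⊆ D⊆E known

PrefixesIn : List Str → Str → Set
PrefixesIn D []      = ⊥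
PrefixesIn D (c ∷ q) = KnownPrefixes D [] c q

PrefixesIn-⊆ : ∀ {D E} q → D ⊆ E → PrefixesIn D q → PrefixesIn E q
PrefixesIn-⊆ (c ∷ q) = KnownPrefixes-⊆

data PrefixClosed (D : List Str) : List Str → Set where
  []  : PrefixClosed D []
  _∷_ : ∀ {q P} → PrefixesIn D q → PrefixClosed (D ++ [ q ]) P → PrefixClosed D (q ∷ P)

PrefixClosed-all : ∀ {D P} → All (PrefixesIn D) P → PrefixClosed D P
PrefixClosed-all []                  = []
PrefixClosed-all {D} {q ∷ P} (k ∷ ks) =
  k ∷ PrefixClosed-all (All.map (λ {q′} → PrefixesIn-⊆ q′ (xs⊆xs++ys D [ q ])) ks)

infixr 5 _++ᴾ_
_++ᴾ_ : ∀ {D P Q} → PrefixClosed D P → PrefixClosed (D ++ P) Q → PrefixClosed D (P ++ Q)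
_++ᴾ_ {D} {Q = Q} [] closedQ = subst (λ E → PrefixClosed E Q) (++-identityʳ D) closedQ
_++ᴾ_ {D} {q ∷ P} {Q} (k ∷ closedP) closedQ =
  k ∷ (closedP ++ᴾ subst (λ E → PrefixClosed E Q) (sym (++-assoc D [ q ] P)) closedQ)

module Ranked (rank : Str → ℕ) where

  data Ascending (B : ℕ) : List Str → ℕ → Set where
    []  : Ascending B [] B
    _∷_ : ∀ {q P B′} → B < rank q → Ascending (rank q) P B′ → Ascending B (q ∷ P) B′

  infixr 5 _++ᴬ_
  _++ᴬ_ : ∀ {B B′ B″ P Q} → Ascending B P B′ → Ascending B′ Q B″ → Ascending B (P ++ Q) B″
  []          ++ᴬ ascQ = ascQ
  (lt ∷ ascP) ++ᴬ ascQ = lt ∷ (ascP ++ᴬ ascQ)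

  Ascending-applyUpTo : ∀ {B} f → (∀ i → rank (f i) < rank (f (suc i))) → B < rank (f 0) →
                        ∀ n → Ascending B (applyUpTo f (suc n)) (rank (f n))
  Ascending-applyUpTo f mono B<f0 zero    = B<f0 ∷ []
  Ascending-applyUpTo f mono B<f0 (suc n) = B<f0 ∷ Ascending-applyUpTo (f ∘ suc) (mono ∘ suc) (mono 0) n

  Ascending-concat-applyUpTo : ∀ {g : ℕ → List Str} {b : ℕ → ℕ} →
                               (∀ i → Ascending (b i) (g i) (b (suc i))) →
                               ∀ n → Ascending (b 0) (concat (applyUpTo g n)) (b n)
  Ascending-concat-applyUpTo asc zero    = []
  Ascending-concat-applyUpTo asc (suc n) = asc 0 ++ᴬ Ascending-concat-applyUpTo (asc ∘ suc) n

  lzFact-concat : ∀ {f D B P B′} → All (λ d → rank d ≤ B) D → Ascending B P B′ →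
                  PrefixClosed D P → length (concat P) ≤ f → lzFact f D (concat P) ≡ P
  lzFact-concat {zero}  _ [] [] _ = refl
  lzFact-concat {suc f} _ [] [] _ = refl
  lzFact-concat {P = [] ∷ _} _ _ (() ∷ _) _
  lzFact-concat {zero} {P = (c ∷ q) ∷ P} _ _ _ ()
  lzFact-concat {suc f} {D} {B} {(c ∷ q) ∷ P} below (B<q ∷ asc) (known ∷ closed) (s≤s len)
    = trans (lzFact-newPhrase (concat P) known new)
            (cong ((c ∷ q) ∷_) (lzFact-concat below′ asc closed (≤-trans (length-++-≤ʳ (concat P) {q}) len)))
    where
      new : c ∷ q ∉ D
      new q∈D = <⇒≱ B<q (All.lookup below q∈D)
      below′ : All (λ d → rank d ≤ rank (c ∷ q)) (D ++ [ c ∷ q ])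
      below′ = ++⁺ (All.map (λ d≤B → ≤-trans d≤B (<⇒≤ B<q)) below) (≤-refl ∷ [])

  z78-concat : ∀ {B P B′} → Ascending B P B′ → PrefixClosed [] P → z78 (concat P) ≡ length P
  z78-concat asc closed = cong length (lzFact-concat [] asc closed ≤-refl)

length-applyUpTo-++ : ∀ {A : Set} (f : ℕ → A) n ys → length (applyUpTo f n ++ ys) ≡ n + length ys
length-applyUpTo-++ f n ys = trans (length-++ (applyUpTo f n)) (cong (_+ length ys) (length-applyUpTo f n))

length-concat-applyUpTo : ∀ {A : Set} (f : ℕ → List A) {c} → (∀ i → length (f i) ≡ c) →
                          ∀ n → length (concat (applyUpTo f n)) ≡ n * c
length-concat-applyUpTo f eq zero    = refl
length-concat-applyUpTo f eq (suc n) =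
  trans (length-++ (f 0)) (cong₂ _+_ (eq 0) (length-concat-applyUpTo (f ∘ suc) (eq ∘ suc) n))

length-concat-++ : ∀ {A : Set} (xss yss : List (List A)) →
                   length (concat (xss ++ yss)) ≡ length (concat xss) + length (concat yss)
length-concat-++ xss yss = trans (cong length (sym (concat-++ xss yss))) (length-++ (concat xss))

length-concat-applyUpTo-++ : ∀ {A : Set} (f : ℕ → List A) {c} → (∀ i → length (f i) ≡ c) →
  ∀ n ys → length (concat (applyUpTo f n ++ ys)) ≡ n * c + length (concat ys)
length-concat-applyUpTo-++ f eq n ys =
  trans (length-concat-++ (applyUpTo f n) ys) (cong (_+ length (concat ys)) (length-concat-applyUpTo f eq n))

concat-applyUpTo-shift : ∀ {A : Set} (c : A) (f : ℕ → A) n r →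
  concat (applyUpTo (λ j → c ∷ f j ∷ []) n) ++ c ∷ r ≡ c ∷ concat (applyUpTo (λ j → f j ∷ c ∷ []) n) ++ r
concat-applyUpTo-shift c f zero    r = refl
concat-applyUpTo-shift c f (suc n) r = cong (λ t → c ∷ f 0 ∷ t) (concat-applyUpTo-shift c (f ∘ suc) n r)

concat-applyUpTo-concat : ∀ {A : Set} (g : ℕ → List (List A)) n →
  concat (applyUpTo (concat ∘ g) n) ≡ concat (concat (applyUpTo g n))
concat-applyUpTo-concat g zero    = refl
concat-applyUpTo-concat g (suc n) = trans (cong (concat (g 0) ++_) (concat-applyUpTo-concat (g ∘ suc) n))
                                          (concat-++ (g 0) (concat (applyUpTo (g ∘ suc) n)))

take-length-++ : ∀ {A : Set} (xs : List A) {ys} → take (length xs) (xs ++ ys) ≡ xs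
take-length-++ []       = refl
take-length-++ (x ∷ xs) = cong (x ∷_) (take-length-++ xs)

drop-length-++ : ∀ {A : Set} (xs : List A) {ys} → drop (length xs) (xs ++ ys) ≡ ys
drop-length-++ []       = refl
drop-length-++ (x ∷ xs) = drop-length-++ xs

drop-suc-length-++ : ∀ {A : Set} (xs : List A) {y ys} → drop (suc (length xs)) (xs ++ y ∷ ys) ≡ ys
drop-suc-length-++ []       = refl
drop-suc-length-++ (x ∷ xs) = drop-suc-length-++ xs

length-<-++-∷ : ∀ {A : Set} (xs : List A) {y ys} → length xs < length (xs ++ y ∷ ys)
length-<-++-∷ []       = z<s
length-<-++-∷ (x ∷ xs) = s≤s (length-<-++-∷ xs)

edit-sub : ∀ A c c′ B → Edit sub (A ++ c ∷ B) (A ++ c′ ∷ B)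
edit-sub A c c′ B = length A , c′ , length-<-++-∷ A ,
  cong₂ (λ X Y → X ++ c′ ∷ Y) (sym (take-length-++ A)) (sym (drop-suc-length-++ A))

edit-del : ∀ A c B → Edit del (A ++ c ∷ B) (A ++ B)
edit-del A c B = length A , length-<-++-∷ A ,
  cong₂ _++_ (sym (take-length-++ A)) (sym (drop-suc-length-++ A))

edit-ins : ∀ A c B → Edit ins (A ++ B) (A ++ c ∷ B)
edit-ins A c B = length A , c , length-++-≤ˡ A ,
  cong₂ (λ X Y → X ++ c ∷ Y) (sym (take-length-++ A)) (sym (drop-length-++ A))

module Construction (m : ℕ) where

  v : ℕ → ℕ
  v j = suc (suc (j + j))

  u x y s : ℕ
  u = v (suc m)
  x = suc (v m)
  y = 1
  s = u * u

  w : ℕ → ℕ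
  w j = s + suc (v j)

  rank : Str → ℕ
  rank = foldl (λ r c → r * u + c) 0

  open Ranked rank

  uv vu uvw : ℕ → Str
  uv  j = u ∷ v j ∷ []
  vu  j = v j ∷ u ∷ []
  uvw j = u ∷ v j ∷ w j ∷ []

  uv-w : ℕ → List Str
  uv-w j = uv j ∷ [ w j ] ∷ []

  letters originalPhrases shiftedPhrases : List Str
  letters         = [ y ] ∷ applyUpTo (λ j → [ v j ]) (suc m)
  originalPhrases = letters ++ [ u ] ∷ applyUpTo uv (suc m) ++ (u ∷ s ∷ []) ∷ applyUpTo uvw (suc m)
  shiftedPhrases  = applyUpTo vu (suc m) ++ [ s ] ∷ concat (applyUpTo uv-w (suc m))

  editedTail : EditType → List Str
  editedTail del = [ u ] ∷ shiftedPhrases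
  editedTail sub = [ x ] ∷ [ u ] ∷ shiftedPhrases
  editedTail ins = [ u ] ∷ (y ∷ u ∷ []) ∷ shiftedPhrases

  editedPhrases : EditType → List Str
  editedPhrases e = letters ++ editedTail e

  text : Str
  text = concat originalPhrases

  v-gap : ∀ j → suc (v j) < v (suc j)
  v-gap j = s≤s (s≤s (s≤s (≤-reflexive (sym (+-suc j j)))))

  v-mono : ∀ j → v j < v (suc j)
  v-mono j = <-trans (n<1+n (v j)) (v-gap j)

  letters-ascending : Ascending 0 letters (v m)
  letters-ascending = z<s ∷ Ascending-applyUpTo (λ j → [ v j ]) v-mono (s≤s z<s) m

  shifted-ascending : ∀ {B} → B < v 0 * u + u → Ascending B shiftedPhrases (w m)
  shifted-ascending B<vu =
    Ascending-applyUpTo vu vu-mono B<vu m ++ᴬ vm-u<s ∷ Ascending-concat-applyUpTo pair (suc m)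
    where
      vu-mono : ∀ j → v j * u + u < v (suc j) * u + u
      vu-mono j = +-monoˡ-< u (*-monoˡ-< u (v-mono j))
      vm-u<s : v m * u + u < s
      vm-u<s = subst (_< s) (+-comm u (v m * u)) (*-monoˡ-< u (v-gap m))
      bound : ℕ → ℕ
      bound zero    = s
      bound (suc j) = w j
      bound<uv : ∀ j → bound j < u * u + v j
      bound<uv zero    = m<m+n s z<s
      bound<uv (suc j) = +-monoʳ-< s (v-gap j)
      pair : ∀ j → Ascending (bound j) (uv-w j) (bound (suc j))
      pair j = bound<uv j ∷ +-monoʳ-< s (n<1+n (v j)) ∷ []

  original-ascending : Ascending 0 originalPhrases ((u * u + v m) * u + w m)
  original-ascending =
    letters-ascending ++ᴬ v-mono m ∷
    Ascending-applyUpTo uv (λ j → +-monoʳ-< (u * u) (v-mono j)) u<uv₀ m ++ᴬ uvₘ<us ∷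
    Ascending-applyUpTo uvw uvw-mono us<uvw₀ m
    where
      u<uv₀ : u < u * u + v 0
      u<uv₀ = ≤-<-trans (m≤m*n u u) (m<m+n (u * u) z<s)
      uvₘ<us : u * u + v m < u * u + s
      uvₘ<us = +-monoʳ-< (u * u) (<-≤-trans (v-mono m) (m≤m*n u u))
      uvw-mono : ∀ j → (u * u + v j) * u + w j < (u * u + v (suc j)) * u + w (suc j)
      uvw-mono j = +-mono-≤-< (*-monoˡ-≤ u (+-monoʳ-≤ (u * u) (<⇒≤ (v-mono j))))
                              (+-monoʳ-< s (s≤s (v-mono j)))
      us<uvw₀ : u * u + s < (u * u + v 0) * u + w 0
      us<uvw₀ = +-mono-≤-< (≤-trans (m≤m+n (u * u) (v 0)) (m≤m*n _ u)) (m<m+n s z<s)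

  edited-ascending : ∀ e → Ascending 0 (editedPhrases e) (w m)
  edited-ascending del = letters-ascending ++ᴬ v-mono m ∷ shifted-ascending (m<n+m u {v 0 * u} z<s)
  edited-ascending sub = letters-ascending ++ᴬ n<1+n (v m) ∷ v-gap m ∷ shifted-ascending (m<n+m u {v 0 * u} z<s)
  edited-ascending ins = letters-ascending ++ᴬ v-mono m ∷ m<n+m u {y * u} z<s ∷
                         shifted-ascending (+-monoˡ-< u (*-monoˡ-< u {y} {v 0} (s≤s z<s)))

  letters-closed : ∀ {D} → PrefixClosed D letters
  letters-closed = PrefixClosed-all (last ∷ applyUpTo⁺₂ (λ j → [ v j ]) (suc m) (λ _ → last))

  shifted-closed : ∀ {D} → letters ⊆ D → [ u ] ∈ D → PrefixClosed D shiftedPhrases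
  shifted-closed letters⊆D u∈D = PrefixClosed-all (++⁺
    (applyUpTo⁺₁ vu (suc m) (λ j<k → letters⊆D (there (∈-applyUpTo⁺ (λ j → [ v j ]) j<k)) ∷ last))
    (last ∷ concat⁺ (applyUpTo⁺₂ uv-w (suc m) (λ _ → (u∈D ∷ last) ∷ last ∷ []))))

  original-closed : PrefixClosed [] originalPhrases
  original-closed = letters-closed ++ᴾ last ∷
    PrefixClosed-all (applyUpTo⁺₂ uv (suc m) (λ _ → u∈ ∷ last)) ++ᴾ
    PrefixClosed-all ((∈-++⁺ˡ u∈ ∷ last) ∷
      applyUpTo⁺₁ uvw (suc m) (λ j<k → ∈-++⁺ˡ u∈ ∷ ∈-++⁺ʳ (letters ++ [ [ u ] ]) (∈-applyUpTo⁺ uv j<k) ∷ last))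
    where
      u∈ : [ u ] ∈ letters ++ [ [ u ] ]
      u∈ = ∈-++⁺ʳ letters (here refl)

  letters⊆ : ∀ ys zs → letters ⊆ (letters ++ ys) ++ zs
  letters⊆ ys zs = ⊆-trans (xs⊆xs++ys letters ys) (xs⊆xs++ys (letters ++ ys) zs)

  edited-closed : ∀ e → PrefixClosed [] (editedPhrases e)
  edited-closed del = letters-closed ++ᴾ last ∷
    shifted-closed (xs⊆xs++ys letters _) (∈-++⁺ʳ letters (here refl))
  edited-closed sub = letters-closed ++ᴾ last ∷ last ∷
    shifted-closed (letters⊆ [ [ x ] ] [ [ u ] ]) (∈-++⁺ʳ (letters ++ [ [ x ] ]) (here refl))
  edited-closed ins = letters-closed ++ᴾ last ∷ (∈-++⁺ˡ {xs = letters} (here refl) ∷ last) ∷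
    shifted-closed (letters⊆ [ [ u ] ] [ y ∷ u ∷ [] ]) (∈-++⁺ˡ (∈-++⁺ʳ letters (here refl)))

  prefix suffix : Str
  prefix = concat letters
  suffix = concat ([ u ] ∷ shiftedPhrases)

  text-split : text ≡ prefix ++ u ∷ suffix
  text-split = begin
    text
      ≡⟨ sym (concat-++ letters _) ⟩
    prefix ++ u ∷ concat (UV ++ (u ∷ s ∷ []) ∷ UVW)
      ≡⟨ cong (λ t → prefix ++ u ∷ t) (sym (concat-++ UV _)) ⟩
    prefix ++ u ∷ concat UV ++ u ∷ s ∷ concat UVW
      ≡⟨ cong (λ t → prefix ++ u ∷ t) (concat-applyUpTo-shift u v (suc m) _) ⟩
    prefix ++ u ∷ u ∷ concat VU ++ s ∷ concat UVW
      ≡⟨ cong (λ t → prefix ++ u ∷ u ∷ concat VU ++ s ∷ t) (concat-applyUpTo-concat uv-w (suc m)) ⟩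
    prefix ++ u ∷ u ∷ concat VU ++ s ∷ concat (concat (applyUpTo uv-w (suc m)))
      ≡⟨ cong (λ t → prefix ++ u ∷ u ∷ t) (concat-++ VU _) ⟩
    prefix ++ u ∷ suffix ∎
    where
      open ≡-Reasoning
      UV VU UVW : List Str
      UV  = applyUpTo uv (suc m)
      VU  = applyUpTo vu (suc m)
      UVW = applyUpTo uvw (suc m)

  edit : ∀ e → Edit e text (concat (editedPhrases e))
  edit del = subst₂ (Edit del) (sym text-split) (concat-++ letters _) (edit-del prefix u suffix)
  edit sub = subst₂ (Edit sub) (sym text-split) (concat-++ letters _) (edit-sub prefix u x suffix)
  edit ins = subst₂ (Edit ins) (trans (++-assoc prefix [ u ] suffix) (sym text-split))
                               (trans (++-assoc prefix [ u ] (y ∷ suffix)) (concat-++ letters _))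
                               (edit-ins (prefix ++ [ u ]) y suffix)

  length-letters-++ : ∀ ys → length (letters ++ ys) ≡ suc (suc m + length ys)
  length-letters-++ ys = cong suc (length-applyUpTo-++ (λ j → [ v j ]) (suc m) ys)

  length-originalPhrases : length originalPhrases ≡ 3 * m + 6
  length-originalPhrases = begin
    length originalPhrases
      ≡⟨ length-letters-++ _ ⟩
    suc (suc m + suc (length (applyUpTo uv (suc m) ++ (u ∷ s ∷ []) ∷ applyUpTo uvw (suc m))))
      ≡⟨ cong (λ n → suc (suc m + suc n)) (length-applyUpTo-++ uv (suc m) _) ⟩
    suc (suc m + suc (suc m + suc (length (applyUpTo uvw (suc m)))))
      ≡⟨ cong (λ n → suc (suc m + suc (suc m + suc n))) (length-applyUpTo uvw (suc m)) ⟩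
    suc (suc m + suc (suc m + suc (suc m)))
      ≡⟨ count m ⟩
    3 * m + 6 ∎
    where
      open ≡-Reasoning
      count : ∀ m → suc (suc m + suc (suc m + suc (suc m))) ≡ 3 * m + 6
      count = solve-∀

  length-shiftedPhrases : length shiftedPhrases ≡ 3 * m + 4
  length-shiftedPhrases = begin
    length shiftedPhrases
      ≡⟨ length-applyUpTo-++ vu (suc m) _ ⟩
    suc m + suc (length (concat (applyUpTo uv-w (suc m))))
      ≡⟨ cong (λ n → suc m + suc n) (length-concat-applyUpTo uv-w (λ _ → refl) (suc m)) ⟩
    suc m + suc (suc m * 2)
      ≡⟨ count m ⟩
    3 * m + 4 ∎
    where
      open ≡-Reasoning
      count : ∀ m → suc m + suc (suc m * 2) ≡ 3 * m + 4
      count = solve-∀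

  editedTail-≥ : ∀ e → length ([ u ] ∷ shiftedPhrases) ≤ length (editedTail e)
  editedTail-≥ del = ≤-refl
  editedTail-≥ sub = n≤1+n _
  editedTail-≥ ins = n≤1+n _

  length-editedPhrases : ∀ e → 4 * m + 7 ≤ length (editedPhrases e)
  length-editedPhrases e = begin
    4 * m + 7                                       ≡⟨ count m ⟩
    suc (suc m + suc (3 * m + 4))                   ≡⟨ cong (λ n → suc (suc m + suc n)) (sym length-shiftedPhrases) ⟩
    suc (suc m + length ([ u ] ∷ shiftedPhrases))   ≤⟨ s≤s (+-monoʳ-≤ (suc m) (editedTail-≥ e)) ⟩
    suc (suc m + length (editedTail e))             ≡⟨ sym (length-letters-++ (editedTail e)) ⟩
    length (editedPhrases e)                        ∎
    where
      open ≤-Reasoning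
      count : ∀ m → 4 * m + 7 ≡ suc (suc m + suc (3 * m + 4))
      count = solve-∀

  length-text : length text ≡ 6 * m + 10
  length-text = begin
    length text
      ≡⟨ cong suc (length-concat-applyUpTo-++ (λ j → [ v j ]) (λ _ → refl) (suc m) _) ⟩
    suc (suc m * 1 + suc (length (concat (applyUpTo uv (suc m) ++ (u ∷ s ∷ []) ∷ applyUpTo uvw (suc m)))))
      ≡⟨ cong (λ n → suc (suc m * 1 + suc n)) (length-concat-applyUpTo-++ uv (λ _ → refl) (suc m) _) ⟩
    suc (suc m * 1 + suc (suc m * 2 + suc (suc (length (concat (applyUpTo uvw (suc m)))))))
      ≡⟨ cong (λ n → suc (suc m * 1 + suc (suc m * 2 + suc (suc n)))) (length-concat-applyUpTo uvw (λ _ → refl) (suc m)) ⟩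
    suc (suc m * 1 + suc (suc m * 2 + suc (suc (suc m * 3))))
      ≡⟨ count m ⟩
    6 * m + 10 ∎
    where
      open ≡-Reasoning
      count : ∀ m → suc (suc m * 1 + suc (suc m * 2 + suc (suc (suc m * 3)))) ≡ 6 * m + 10
      count = solve-∀

  length-text-≥ : length text ≥ m
  length-text-≥ = subst (m ≤_) (sym length-text) (≤-trans (m≤n*m m 6) (m≤m+n (6 * m) 10))

  z78-text : z78 text ≡ 3 * m + 6
  z78-text = trans (z78-concat original-ascending original-closed) length-originalPhrases

  z78-edited : ∀ e → 4 * m + 7 ≤ z78 (concat (editedPhrases e))
  z78-edited e = subst (4 * m + 7 ≤_) (sym (z78-concat (edited-ascending e) (edited-closed e)))
                       (length-editedPhrases e)

  gain : ∀ e → 10 * z78 text + 1 * length text ≤ 10 * z78 (concat (editedPhrases e))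
  gain e = begin
    10 * z78 text + 1 * length text     ≡⟨ cong₂ (λ z n → 10 * z + 1 * n) z78-text length-text ⟩
    10 * (3 * m + 6) + 1 * (6 * m + 10) ≤⟨ subst (10 * (3 * m + 6) + 1 * (6 * m + 10) ≤_) (count m) (m≤m+n _ (4 * m)) ⟩
    10 * (4 * m + 7)                    ≤⟨ *-monoʳ-≤ 10 (z78-edited e) ⟩
    10 * z78 (concat (editedPhrases e)) ∎
    where
      open ≤-Reasoning
      count : ∀ m → 10 * (3 * m + 6) + 1 * (6 * m + 10) + 4 * m ≡ 10 * (4 * m + 7)
      count = solve-∀

theorem8 : (e : EditType) →
    ∃[ a ] ∃[ b ] ((m : ℕ) → ∃[ n ] (n ≥ m × ∃[ T ] ∃[ T' ]
    (length T ≡ n × Edit e T T' × suc b * z78 T + suc a * n ≤ suc b * z78 T')))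
theorem8 e = 0 , 9 , λ m → let open Construction m in
  length text , length-text-≥ , text , concat (editedPhrases e) , refl , edit e , gain e
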